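{- Let $\beta$ be odd and let $\mathcal C=\langle (b\mid 0),(\ell\mid fh+2f)\rangle$ be a $\mathbb{Z}_2\mathbb{Z}_4$-additive cyclic code, where $f,g,h\in\mathbb{Z}_4[x]$ are monic pairwise coprime with $fhg=x^\beta-1$, $b,\ell\in\mathbb{Z}_2[x]$, $b\mid x^\alpha-1$, $\deg(\ell)<\deg(b)$, and $b$ divides $\frac{x^\beta-1}{f}\ell\pmod 2$. Then the subcode $\mathcal C_b$ of $\mathcal C$ consisting of all codewords of order at most $2$ satisfies $$\mathcal C_b=\langle (b\mid 0),(\ell g\mid 2fg),(0\mid 2fh)\rangle.$$
   Context: A $\mathbb{Z}_2\mathbb{Z}_4$-additive code is a subgroup of $\mathbb{Z}_2^\alpha\times\mathbb{Z}_4^\beta$; it is cyclic if invariant under simultaneously cyclically shifting the $\alpha$ binary coordinates and the $\beta$ quaternary coordinates. Vectors $(u\mid u')$ are identified with elements $(u(x)\mid u'(x))$ of $R_{\alpha,\beta}=\mathbb{Z}_2[x]/(x^\alpha-1)\times\mathbb{Z}_4[x]/(x^\beta-1)$, which is a $\mathbb{Z}_4[x]$-module via $\lambda\star(p\mid q)=(\lambda p\bmod 2\mid\lambda q)$; cyclic codes are exactly the submodules, and $\langle\cdot\rangle$ denotes the generated submodule. In the binary component, $\ell g$ means $\ell g$ reduced mod 2. -}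

module Defs where

open import Data.Nat using (ℕ; zero; suc; _≤_)
open import Data.List using (List; []; _∷_; map)
open import Data.Vec using (Vec; []; _∷_; replicate; zipWith; toList)
open import Data.Product using (Σ; ∃; _×_; _,_)
open import Relation.Binary.PropositionalEquality using (_≡_; _≢_)

data Z₂ : Set where
  0₂ 1₂ : Z₂

_+₂_ : Z₂ → Z₂ → Z₂
0₂ +₂ y = y
1₂ +₂ 0₂ = 1₂
1₂ +₂ 1₂ = 0₂

_*₂_ : Z₂ → Z₂ → Z₂
0₂ *₂ y = 0₂
1₂ *₂ y = y

data Z₄ : Set where
  0₄ 1₄ 2₄ 3₄ : Z₄

suc₄ : Z₄ → Z₄
suc₄ 0₄ = 1₄
suc₄ 1₄ = 2₄
suc₄ 2₄ = 3₄
suc₄ 3₄ = 0₄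

_+₄_ : Z₄ → Z₄ → Z₄
0₄ +₄ y = y
1₄ +₄ y = suc₄ y
2₄ +₄ y = suc₄ (suc₄ y)
3₄ +₄ y = suc₄ (suc₄ (suc₄ y))

_*₄_ : Z₄ → Z₄ → Z₄
0₄ *₄ y = 0₄
1₄ *₄ y = y
2₄ *₄ y = y +₄ y
3₄ *₄ y = y +₄ (y +₄ y)

red₂ : Z₄ → Z₂
red₂ 0₄ = 0₂
red₂ 1₄ = 1₂
red₂ 2₄ = 0₂
red₂ 3₄ = 1₂

-- Polynomials as coefficient lists (constant term first; trailing
-- zeros allowed), with operations generic in the coefficient ring.

Poly : Set → Set
Poly A = List A

module PolyOps {A : Set} (0# 1# : A) (_+_ _*_ : A → A → A) where

  coeff : Poly A → ℕ → A
  coeff []       _       = 0#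
  coeff (a ∷ p)  zero    = a
  coeff (a ∷ p)  (suc i) = coeff p i

  _≈ₚ_ : Poly A → Poly A → Set
  p ≈ₚ q = ∀ i → coeff p i ≡ coeff q i

  _+ₚ_ : Poly A → Poly A → Poly A
  []      +ₚ q       = q
  (a ∷ p) +ₚ []      = a ∷ p
  (a ∷ p) +ₚ (b ∷ q) = (a + b) ∷ (p +ₚ q)

  _*ₚ_ : Poly A → Poly A → Poly A
  []      *ₚ q = []
  (a ∷ p) *ₚ q = map (a *_) q +ₚ (0# ∷ (p *ₚ q))

  oneₚ : Poly A
  oneₚ = 1# ∷ []

  _∣ₚ_ : Poly A → Poly A → Set
  a ∣ₚ c = Σ (Poly A) λ q → (a *ₚ q) ≈ₚ c

  HasDegree : Poly A → ℕ → Set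
  HasDegree p n = (coeff p n ≢ 0#) × (∀ m → suc n ≤ m → coeff p m ≡ 0#)

  Monic : Poly A → Set
  Monic p = Σ ℕ λ n → HasDegree p n × coeff p n ≡ 1#

  -- deg(p) < deg(q)  (with deg 0 = -∞; forces q ≠ 0)
  DegLt : Poly A → Poly A → Set
  DegLt p q = Σ ℕ λ n → HasDegree q n × (∀ m → n ≤ m → coeff p m ≡ 0#)

  Coprime : Poly A → Poly A → Set
  Coprime p q = Σ (Poly A) λ a → Σ (Poly A) λ c → ((a *ₚ p) +ₚ (c *ₚ q)) ≈ₚ oneₚ

  -- x^n - 1 (uses -1 = m1)
  xⁿ-1 : A → ℕ → Poly A
  xⁿ-1 m1 zero    = []
  xⁿ-1 m1 (suc k) = m1 ∷ go k
    where
    go : ℕ → Poly A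
    go zero    = 1# ∷ []
    go (suc j) = 0# ∷ go j

  lastOf : A → {n : ℕ} → Vec A n → A
  lastOf x []       = x
  lastOf x (y ∷ ys) = lastOf y ys

  dropLast : A → {n : ℕ} → Vec A n → Vec A n
  dropLast x []       = []
  dropLast x (y ∷ ys) = x ∷ dropLast y ys

  -- multiplication by x in A[x]/(x^n - 1)
  rot : {n : ℕ} → Vec A n → Vec A n
  rot []       = []
  rot (x ∷ xs) = lastOf x xs ∷ dropLast x xs

  addConst : A → {n : ℕ} → Vec A n → Vec A n
  addConst c []       = []
  addConst c (x ∷ xs) = (c + x) ∷ xs

  reduce : (n : ℕ) → Poly A → Vec A n
  reduce n []      = replicate n 0#
  reduce n (c ∷ p) = addConst c (rot (reduce n p))

module P₂ = PolyOps 0₂ 1₂ _+₂_ _*₂_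
module P₄ = PolyOps 0₄ 1₄ _+₄_ _*₄_

mod2 : Poly Z₄ → Poly Z₂
mod2 = map red₂

-- R_{α,β} = Z₂[x]/(x^α-1) × Z₄[x]/(x^β-1), elements stored as
-- canonical coefficient vectors.

record R (α β : ℕ) : Set where
  constructor ⟪_∣_⟫
  field
    bin  : Vec Z₂ α
    quat : Vec Z₄ β

module _ {α β : ℕ} where

  0R : R α β
  0R = ⟪ replicate α 0₂ ∣ replicate β 0₄ ⟫

  _+R_ : R α β → R α β → R α β
  ⟪ u ∣ u' ⟫ +R ⟪ v ∣ v' ⟫ = ⟪ zipWith _+₂_ u v ∣ zipWith _+₄_ u' v' ⟫

  [_∣_] : Poly Z₂ → Poly Z₄ → R α β
  [ p ∣ q ] = ⟪ P₂.reduce α p ∣ P₄.reduce β q ⟫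

  _⋆_ : Poly Z₄ → R α β → R α β
  l ⋆ ⟪ u ∣ u' ⟫ = [ mod2 l P₂.*ₚ toList u ∣ l P₄.*ₚ toList u' ]

  _∈⟨_⟩ : R α β → List (R α β) → Set
  v ∈⟨ [] ⟩     = v ≡ 0R
  v ∈⟨ g ∷ gs ⟩ = Σ (Poly Z₄) λ l → Σ (R α β) λ w → (w ∈⟨ gs ⟩) × (v ≡ (l ⋆ g) +R w)

  OrderLe2 : R α β → Set
  OrderLe2 v = v +R v ≡ 0R

2· : Poly Z₄ → Poly Z₄
2· = map (2₄ *₄_)

module Submission where

open import Defs
open import Data.Nat using (ℕ; _%_)
open import Data.List using (List; []; _∷_)
open import Data.Product using (_×_)
open import Function.Bundles using (_⇔_)
open import Relation.Binary.PropositionalEquality using (_≡_)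

open import Data.Nat using (zero; suc; _≤_; s≤s)
open import Data.Nat.Properties using (m≤n⇒m≤1+n; ≤-refl)
open import Data.List using (map; length)
open import Data.Vec as V using (Vec; []; _∷_; replicate; zipWith; toList)
open import Data.Vec.Properties using (length-toList)
open import Data.Product using (Σ; _,_; proj₁; proj₂)
open import Function.Bundles using (mk⇔)
open import Relation.Binary.PropositionalEquality using (refl; sym; trans; cong; cong₂; subst; module ≡-Reasoning)
open import Relation.Binary.Bundles using (Setoid)
open import Algebra.Bundles using (CommutativeRing)
import Relation.Binary.Reasoning.Setoid as SetoidReasoning

-- The heart of the proof is the identity
--     (g·μ + 2·ν)·(ℓ ∣ fh + 2f) = μ·(ℓḡ ∣ 2fg) + ν·(0 ∣ 2fh)      (`split-generator`),
-- valid because fhg ≡ 0 modulo xᵝ - 1 and 2·2 = 0 in Z₄.  It shows that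
-- ⟨(b ∣ 0), (ℓḡ ∣ 2fg), (0 ∣ 2fh)⟩ ⊆ C, and elements of this span have order
-- ≤ 2 since their quaternary part is a multiple of 2.  Conversely, if
-- l₁·(b ∣ 0) + l₂·(ℓ ∣ fh + 2f) has order ≤ 2, its quaternary part vanishes
-- mod 2, so xᵝ - 1 = f̄h̄ḡ divides l̄₂·f̄h̄ in Z₂[x]; since ḡ is coprime to f̄h̄ it
-- divides l̄₂, and lifting to Z₄[x] gives l₂ = g·μ + 2·ν, so the identity applies.

record CommRingLaws {A : Set} (0# 1# : A) (_+_ _*_ : A → A → A) (-_ : A → A) : Set where
  field
    +-assoc  : ∀ x y z → (x + y) + z ≡ x + (y + z)
    +-comm   : ∀ x y → x + y ≡ y + x
    +-idˡ    : ∀ x → 0# + x ≡ x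
    -‿invˡ   : ∀ x → (- x) + x ≡ 0#
    *-assoc  : ∀ x y z → (x * y) * z ≡ x * (y * z)
    *-comm   : ∀ x y → x * y ≡ y * x
    *-idˡ    : ∀ x → 1# * x ≡ x
    *-zeroˡ  : ∀ x → 0# * x ≡ 0#
    distribˡ : ∀ x y z → x * (y + z) ≡ (x * y) + (x * z)

every₂ : {P : Z₂ → Set} → P 0₂ → P 1₂ → ∀ x → P x
every₂ p0 p1 0₂ = p0
every₂ p0 p1 1₂ = p1

every₄ : {P : Z₄ → Set} → P 0₄ → P 1₄ → P 2₄ → P 3₄ → ∀ x → P x
every₄ p0 p1 p2 p3 0₄ = p0
every₄ p0 p1 p2 p3 1₄ = p1
every₄ p0 p1 p2 p3 2₄ = p2
every₄ p0 p1 p2 p3 3₄ = p3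

Z₂-laws : CommRingLaws 0₂ 1₂ _+₂_ _*₂_ (λ x → x)
Z₂-laws = record
  { +-assoc  = every₂ (every₂ (every₂ refl refl) (every₂ refl refl)) (every₂ (every₂ refl refl) (every₂ refl refl))
  ; +-comm   = every₂ (every₂ refl refl) (every₂ refl refl)
  ; +-idˡ    = λ _ → refl
  ; -‿invˡ   = every₂ refl refl
  ; *-assoc  = every₂ (λ _ _ → refl) (λ _ _ → refl)
  ; *-comm   = every₂ (every₂ refl refl) (every₂ refl refl)
  ; *-idˡ    = λ _ → refl
  ; *-zeroˡ  = λ _ → refl
  ; distribˡ = every₂ (λ _ _ → refl) (λ _ _ → refl)
  }

Z₄-laws : CommRingLaws 0₄ 1₄ _+₄_ _*₄_ (3₄ *₄_)
Z₄-laws = record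
  { +-assoc  = every₄ (λ _ _ → refl)
                 (every₄ (every₄ refl refl refl refl) (every₄ refl refl refl refl)
                         (every₄ refl refl refl refl) (every₄ refl refl refl refl))
                 (every₄ (every₄ refl refl refl refl) (every₄ refl refl refl refl)
                         (every₄ refl refl refl refl) (every₄ refl refl refl refl))
                 (every₄ (every₄ refl refl refl refl) (every₄ refl refl refl refl)
                         (every₄ refl refl refl refl) (every₄ refl refl refl refl))
  ; +-comm   = every₄ (every₄ refl refl refl refl) (every₄ refl refl refl refl)
                        (every₄ refl refl refl refl) (every₄ refl refl refl refl)
  ; +-idˡ    = λ _ → refl
  ; -‿invˡ   = every₄ refl refl refl refl
  ; *-assoc  = every₄ (λ _ _ → refl) (λ _ _ → refl)
                 (every₄ (every₄ refl refl refl refl) (every₄ refl refl refl refl)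
                         (every₄ refl refl refl refl) (every₄ refl refl refl refl))
                 (every₄ (every₄ refl refl refl refl) (every₄ refl refl refl refl)
                         (every₄ refl refl refl refl) (every₄ refl refl refl refl))
  ; *-comm   = every₄ (every₄ refl refl refl refl) (every₄ refl refl refl refl)
                        (every₄ refl refl refl refl) (every₄ refl refl refl refl)
  ; *-idˡ    = λ _ → refl
  ; *-zeroˡ  = λ _ → refl
  ; distribˡ = every₄ (λ _ _ → refl) (λ _ _ → refl)
                 (every₄ (every₄ refl refl refl refl) (every₄ refl refl refl refl)
                         (every₄ refl refl refl refl) (every₄ refl refl refl refl))
                 (every₄ (every₄ refl refl refl refl) (every₄ refl refl refl refl)
                         (every₄ refl refl refl refl) (every₄ refl refl refl refl))
  }

red₂-+ : ∀ x y → red₂ (x +₄ y) ≡ red₂ x +₂ red₂ y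
red₂-+ = every₄ (λ _ → refl) (every₄ refl refl refl refl) (every₄ refl refl refl refl) (every₄ refl refl refl refl)

red₂-* : ∀ x y → red₂ (x *₄ y) ≡ red₂ x *₂ red₂ y
red₂-* = every₄ (λ _ → refl) (λ _ → refl) (every₄ refl refl refl refl) (every₄ refl refl refl refl)

module CoefficientMap {A B : Set} {0a 1a : A} {_+a_ _*a_ : A → A → A}
                      {0b 1b : B} {_+b_ _*b_ : B → B → B}
                      (φ : A → B) (φ-0 : φ 0a ≡ 0b) (φ-+ : ∀ x y → φ (x +a y) ≡ φ x +b φ y) where
  private
    module PA = PolyOps 0a 1a _+a_ _*a_
    module PB = PolyOps 0b 1b _+b_ _*b_

  lastOf-map : ∀ {n} x (xs : Vec A n) → φ (PA.lastOf x xs) ≡ PB.lastOf (φ x) (V.map φ xs)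
  lastOf-map x []       = refl
  lastOf-map x (y ∷ ys) = lastOf-map y ys

  dropLast-map : ∀ {n} x (xs : Vec A n) → V.map φ (PA.dropLast x xs) ≡ PB.dropLast (φ x) (V.map φ xs)
  dropLast-map x []       = refl
  dropLast-map x (y ∷ ys) = cong (φ x ∷_) (dropLast-map y ys)

  rot-map : ∀ {n} (v : Vec A n) → V.map φ (PA.rot v) ≡ PB.rot (V.map φ v)
  rot-map []       = refl
  rot-map (x ∷ xs) = cong₂ _∷_ (lastOf-map x xs) (dropLast-map x xs)

  addConst-map : ∀ {n} c (v : Vec A n) → V.map φ (PA.addConst c v) ≡ PB.addConst (φ c) (V.map φ v)
  addConst-map c []       = refl
  addConst-map c (x ∷ xs) = cong (_∷ V.map φ xs) (φ-+ c x)

  replicate-map : ∀ n → V.map φ (replicate n 0a) ≡ replicate n 0b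
  replicate-map zero    = refl
  replicate-map (suc n) = cong₂ _∷_ φ-0 (replicate-map n)

  reduce-map : ∀ n p → PB.reduce n (map φ p) ≡ V.map φ (PA.reduce n p)
  reduce-map n []      = sym (replicate-map n)
  reduce-map n (c ∷ p) = begin
    PB.addConst (φ c) (PB.rot (PB.reduce n (map φ p)))
      ≡⟨ cong (λ v → PB.addConst (φ c) (PB.rot v)) (reduce-map n p) ⟩
    PB.addConst (φ c) (PB.rot (V.map φ (PA.reduce n p))) ≡⟨ cong (PB.addConst (φ c)) (rot-map (PA.reduce n p)) ⟨
    PB.addConst (φ c) (V.map φ (PA.rot (PA.reduce n p))) ≡⟨ addConst-map c (PA.rot (PA.reduce n p)) ⟨
    V.map φ (PA.addConst c (PA.rot (PA.reduce n p)))     ∎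
    where open ≡-Reasoning

  coeff-map : ∀ p i → PB.coeff (map φ p) i ≡ φ (PA.coeff p i)
  coeff-map []      i       = sym φ-0
  coeff-map (a ∷ p) zero    = refl
  coeff-map (a ∷ p) (suc i) = coeff-map p i

  map-cong : ∀ {p q} → PA._≈ₚ_ p q → PB._≈ₚ_ (map φ p) (map φ q)
  map-cong {p} {q} p≈q i = trans (coeff-map p i) (trans (cong φ (p≈q i)) (sym (coeff-map q i)))

  map-+ : ∀ p q → map φ (PA._+ₚ_ p q) ≡ PB._+ₚ_ (map φ p) (map φ q)
  map-+ []      q       = refl
  map-+ (a ∷ p) []      = refl
  map-+ (a ∷ p) (b ∷ q) = cong₂ _∷_ (φ-+ a b) (map-+ p q)

  module Multiplicative (φ-* : ∀ x y → φ (x *a y) ≡ φ x *b φ y) where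
    map-* : ∀ p q → map φ (PA._*ₚ_ p q) ≡ PB._*ₚ_ (map φ p) (map φ q)
    map-* []      q = refl
    map-* (a ∷ p) q =
      trans (map-+ (map (a *a_) q) (0a ∷ PA._*ₚ_ p q)) (cong₂ PB._+ₚ_ (map-scale q) (cong₂ _∷_ φ-0 (map-* p q)))
      where
      map-scale : ∀ q → map φ (map (a *a_) q) ≡ map (φ a *b_) (map φ q)
      map-scale []      = refl
      map-scale (b ∷ q) = cong₂ _∷_ (φ-* a b) (map-scale q)

-- The polynomial ring A[x] over a commutative ring A, with polynomials
-- compared coefficientwise; it is packaged as a `CommutativeRing` so that
-- identities in A[x] can be discharged by the ring solver.
module Polynomials {A : Set} {0# 1# : A} {_+_ _*_ : A → A → A} { -_ : A → A}
                   (laws : CommRingLaws 0# 1# _+_ _*_ -_) where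
  open CommRingLaws laws
  open PolyOps 0# 1# _+_ _*_

  +-idʳ : ∀ x → x + 0# ≡ x
  +-idʳ x = trans (+-comm x 0#) (+-idˡ x)

  *-zeroʳ : ∀ x → x * 0# ≡ 0#
  *-zeroʳ x = trans (*-comm x 0#) (*-zeroˡ x)

  -0≡0 : - 0# ≡ 0#
  -0≡0 = trans (sym (+-idʳ (- 0#))) (-‿invˡ 0#)

  distribʳ : ∀ x y z → (y + z) * x ≡ (y * x) + (z * x)
  distribʳ x y z = trans (*-comm (y + z) x) (trans (distribˡ x y z) (cong₂ _+_ (*-comm x y) (*-comm x z)))

  -- Coefficientwise equality, wrapped in a record so that the compared
  -- polynomials can be inferred from a proof.
  infix 4 _≈_
  record _≈_ (p q : Poly A) : Set where
    constructor mk
    field get : p ≈ₚ q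
  open _≈_ public

  ≈-refl : ∀ {p} → p ≈ p
  ≈-refl = mk λ i → refl

  ≈-sym : ∀ {p q} → p ≈ q → q ≈ p
  ≈-sym e = mk λ i → sym (get e i)

  ≈-trans : ∀ {p q r} → p ≈ q → q ≈ r → p ≈ r
  ≈-trans e e' = mk λ i → trans (get e i) (get e' i)

  ≡⇒≈ : ∀ {p q} → p ≡ q → p ≈ q
  ≡⇒≈ refl = ≈-refl

  setoid : Setoid _ _
  setoid = record { _≈_ = _≈_ ; isEquivalence = record { refl = ≈-refl ; sym = ≈-sym ; trans = ≈-trans } }

  module ≈-Reasoning = SetoidReasoning setoid

  ∷-cong : ∀ {a b p q} → a ≡ b → p ≈ q → (a ∷ p) ≈ (b ∷ q)
  ∷-cong a≡b p≈q = mk λ { zero → a≡b ; (suc i) → get p≈q i }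

  ∷-injective : ∀ {a b p q} → (a ∷ p) ≈ (b ∷ q) → (a ≡ b) × (p ≈ q)
  ∷-injective e = get e zero , mk λ i → get e (suc i)

  0∷-zero : ∀ {s} → s ≈ [] → (0# ∷ s) ≈ []
  0∷-zero s≈0 = mk λ { zero → refl ; (suc i) → get s≈0 i }

  ∷-zero-inv : ∀ {a s} → (a ∷ s) ≈ [] → (a ≡ 0#) × (s ≈ [])
  ∷-zero-inv e = get e zero , mk λ i → get e (suc i)

  coeff-+ : ∀ p q i → coeff (p +ₚ q) i ≡ coeff p i + coeff q i
  coeff-+ []      q       i       = sym (+-idˡ _)
  coeff-+ (a ∷ p) []      i       = sym (+-idʳ _)
  coeff-+ (a ∷ p) (b ∷ q) zero    = refl
  coeff-+ (a ∷ p) (b ∷ q) (suc i) = coeff-+ p q i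

  coeff-map : (φ : A → A) → φ 0# ≡ 0# → ∀ p i → coeff (map φ p) i ≡ φ (coeff p i)
  coeff-map φ φ-0 []      i       = sym φ-0
  coeff-map φ φ-0 (a ∷ p) zero    = refl
  coeff-map φ φ-0 (a ∷ p) (suc i) = coeff-map φ φ-0 p i

  +-cong : ∀ {p p' q q'} → p ≈ p' → q ≈ q' → (p +ₚ q) ≈ (p' +ₚ q')
  +-cong {p} {p'} {q} {q'} e e' =
    mk λ i → trans (coeff-+ p q i) (trans (cong₂ _+_ (get e i) (get e' i)) (sym (coeff-+ p' q' i)))

  +-assocₚ : ∀ p q r → ((p +ₚ q) +ₚ r) ≈ (p +ₚ (q +ₚ r))
  +-assocₚ p q r = mk λ i → begin
    coeff ((p +ₚ q) +ₚ r) i               ≡⟨ trans (coeff-+ (p +ₚ q) r i) (cong (_+ coeff r i) (coeff-+ p q i)) ⟩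
    (coeff p i + coeff q i) + coeff r i   ≡⟨ +-assoc _ _ _ ⟩
    coeff p i + (coeff q i + coeff r i)   ≡⟨ trans (coeff-+ p (q +ₚ r) i) (cong (coeff p i +_) (coeff-+ q r i)) ⟨
    coeff (p +ₚ (q +ₚ r)) i               ∎
    where open ≡-Reasoning

  +-commₚ : ∀ p q → (p +ₚ q) ≈ (q +ₚ p)
  +-commₚ p q = mk λ i → trans (coeff-+ p q i) (trans (+-comm _ _) (sym (coeff-+ q p i)))

  +-idʳₚ : ∀ p → (p +ₚ []) ≈ p
  +-idʳₚ p = mk λ i → trans (coeff-+ p [] i) (+-idʳ _)

  -ₚ_ : Poly A → Poly A
  -ₚ_ = map -_

  -‿invˡₚ : ∀ p → ((-ₚ p) +ₚ p) ≈ []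
  -‿invˡₚ p = mk λ i →
    trans (coeff-+ (-ₚ p) p i) (trans (cong (_+ coeff p i) (coeff-map -_ -0≡0 p i)) (-‿invˡ _))

  -‿cong : ∀ {p q} → p ≈ q → (-ₚ p) ≈ (-ₚ q)
  -‿cong {p} {q} e = mk λ i →
    trans (coeff-map -_ -0≡0 p i) (trans (cong -_ (get e i)) (sym (coeff-map -_ -0≡0 q i)))

  +-interchange : ∀ a b c d → ((a +ₚ b) +ₚ (c +ₚ d)) ≈ ((a +ₚ c) +ₚ (b +ₚ d))
  +-interchange a b c d = begin
    (a +ₚ b) +ₚ (c +ₚ d)   ≈⟨ +-assocₚ a b (c +ₚ d) ⟩
    a +ₚ (b +ₚ (c +ₚ d))   ≈⟨ +-cong (≈-refl {a}) (+-assocₚ b c d) ⟨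
    a +ₚ ((b +ₚ c) +ₚ d)   ≈⟨ +-cong (≈-refl {a}) (+-cong (+-commₚ b c) ≈-refl) ⟩
    a +ₚ ((c +ₚ b) +ₚ d)   ≈⟨ +-cong (≈-refl {a}) (+-assocₚ c b d) ⟩
    a +ₚ (c +ₚ (b +ₚ d))   ≈⟨ +-assocₚ a c (b +ₚ d) ⟨
    (a +ₚ c) +ₚ (b +ₚ d)   ∎
    where open ≈-Reasoning

  scale : A → Poly A → Poly A
  scale a = map (a *_)

  coeff-scale : ∀ a p i → coeff (scale a p) i ≡ a * coeff p i
  coeff-scale a = coeff-map (a *_) (*-zeroʳ a)

  scale-cong : ∀ a {p q} → p ≈ q → scale a p ≈ scale a q
  scale-cong a {p} {q} e = mk λ i →
    trans (coeff-scale a p i) (trans (cong (a *_) (get e i)) (sym (coeff-scale a q i)))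

  scale-distribˡ : ∀ a p q → scale a (p +ₚ q) ≈ (scale a p +ₚ scale a q)
  scale-distribˡ a p q = mk λ i → begin
    coeff (scale a (p +ₚ q)) i           ≡⟨ trans (coeff-scale a (p +ₚ q) i) (cong (a *_) (coeff-+ p q i)) ⟩
    a * (coeff p i + coeff q i)          ≡⟨ distribˡ _ _ _ ⟩
    (a * coeff p i) + (a * coeff q i)    ≡⟨ cong₂ _+_ (coeff-scale a p i) (coeff-scale a q i) ⟨
    coeff (scale a p) i + coeff (scale a q) i ≡⟨ coeff-+ (scale a p) (scale a q) i ⟨
    coeff (scale a p +ₚ scale a q) i     ∎
    where open ≡-Reasoning

  scale-distribʳ : ∀ a b p → scale (a + b) p ≈ (scale a p +ₚ scale b p)
  scale-distribʳ a b p = mk λ i → begin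
    coeff (scale (a + b) p) i            ≡⟨ trans (coeff-scale (a + b) p i) (distribʳ _ _ _) ⟩
    (a * coeff p i) + (b * coeff p i)    ≡⟨ cong₂ _+_ (coeff-scale a p i) (coeff-scale b p i) ⟨
    coeff (scale a p) i + coeff (scale b p) i ≡⟨ coeff-+ (scale a p) (scale b p) i ⟨
    coeff (scale a p +ₚ scale b p) i     ∎
    where open ≡-Reasoning

  scale-scale : ∀ a b p → scale a (scale b p) ≈ scale (a * b) p
  scale-scale a b p = mk λ i →
    trans (coeff-scale a (scale b p) i) (trans (cong (a *_) (coeff-scale b p i))
      (trans (sym (*-assoc _ _ _)) (sym (coeff-scale (a * b) p i))))

  scale-0 : ∀ p → scale 0# p ≈ []
  scale-0 p = mk λ i → trans (coeff-scale 0# p i) (*-zeroˡ _)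

  scale-1 : ∀ p → scale 1# p ≈ p
  scale-1 p = mk λ i → trans (coeff-scale 1# p i) (*-idˡ _)

  *-zeroˡₚ : ∀ {p} q → p ≈ [] → (p *ₚ q) ≈ []
  *-zeroˡₚ {[]}    q e = ≈-refl
  *-zeroˡₚ {a ∷ p} q e with ∷-zero-inv e
  ... | refl , p≈0 = +-cong (scale-0 q) (0∷-zero (*-zeroˡₚ q p≈0))

  *-zeroʳₚ : ∀ p → (p *ₚ []) ≈ []
  *-zeroʳₚ []      = ≈-refl
  *-zeroʳₚ (a ∷ p) = 0∷-zero (*-zeroʳₚ p)

  *-congˡ : ∀ {p p'} q → p ≈ p' → (p *ₚ q) ≈ (p' *ₚ q)
  *-congˡ {[]}    {[]}      q e = ≈-refl
  *-congˡ {[]}    {a' ∷ p'} q e = ≈-sym (*-zeroˡₚ q (≈-sym e))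
  *-congˡ {a ∷ p} {[]}      q e = *-zeroˡₚ q e
  *-congˡ {a ∷ p} {a' ∷ p'} q e with ∷-injective e
  ... | refl , p≈p' = +-cong (≈-refl {scale a q}) (∷-cong refl (*-congˡ q p≈p'))

  *-congʳ : ∀ p {q q'} → q ≈ q' → (p *ₚ q) ≈ (p *ₚ q')
  *-congʳ []      e = ≈-refl
  *-congʳ (a ∷ p) e = +-cong (scale-cong a e) (∷-cong refl (*-congʳ p e))

  *-cong : ∀ {p p' q q'} → p ≈ p' → q ≈ q' → (p *ₚ q) ≈ (p' *ₚ q')
  *-cong {p} {p'} {q} e e' = ≈-trans (*-congˡ q e) (*-congʳ p' e')

  *-∷ʳ : ∀ p b q → (p *ₚ (b ∷ q)) ≈ (scale b p +ₚ (0# ∷ (p *ₚ q)))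
  *-∷ʳ []      b q = ≈-sym (0∷-zero ≈-refl)
  *-∷ʳ (a ∷ p) b q = ∷-cong (cong (_+ 0#) (*-comm a b)) (begin
    scale a q +ₚ (p *ₚ (b ∷ q))                        ≈⟨ +-cong (≈-refl {scale a q}) (*-∷ʳ p b q) ⟩
    scale a q +ₚ (scale b p +ₚ (0# ∷ (p *ₚ q)))        ≈⟨ +-assocₚ (scale a q) (scale b p) _ ⟨
    (scale a q +ₚ scale b p) +ₚ (0# ∷ (p *ₚ q))        ≈⟨ +-cong (+-commₚ (scale a q) (scale b p)) ≈-refl ⟩
    (scale b p +ₚ scale a q) +ₚ (0# ∷ (p *ₚ q))        ≈⟨ +-assocₚ (scale b p) (scale a q) _ ⟩
    scale b p +ₚ (scale a q +ₚ (0# ∷ (p *ₚ q)))        ∎)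
    where open ≈-Reasoning

  *-commₚ : ∀ p q → (p *ₚ q) ≈ (q *ₚ p)
  *-commₚ []      q = ≈-sym (*-zeroʳₚ q)
  *-commₚ (a ∷ p) q =
    ≈-trans (+-cong (≈-refl {scale a q}) (∷-cong refl (*-commₚ p q))) (≈-sym (*-∷ʳ q a p))

  *-distribʳₚ : ∀ p p' q → ((p +ₚ p') *ₚ q) ≈ ((p *ₚ q) +ₚ (p' *ₚ q))
  *-distribʳₚ []      p'       q = ≈-refl
  *-distribʳₚ (a ∷ p) []       q = ≈-sym (+-idʳₚ _)
  *-distribʳₚ (a ∷ p) (b ∷ p') q = begin
    scale (a + b) q +ₚ (0# ∷ ((p +ₚ p') *ₚ q))
      ≈⟨ +-cong (scale-distribʳ a b q) (∷-cong (sym (+-idˡ 0#)) (*-distribʳₚ p p' q)) ⟩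
    (scale a q +ₚ scale b q) +ₚ ((0# ∷ (p *ₚ q)) +ₚ (0# ∷ (p' *ₚ q)))
      ≈⟨ +-interchange (scale a q) (scale b q) (0# ∷ (p *ₚ q)) (0# ∷ (p' *ₚ q)) ⟩
    (scale a q +ₚ (0# ∷ (p *ₚ q))) +ₚ (scale b q +ₚ (0# ∷ (p' *ₚ q))) ∎
    where open ≈-Reasoning

  *-distribˡₚ : ∀ p q q' → (p *ₚ (q +ₚ q')) ≈ ((p *ₚ q) +ₚ (p *ₚ q'))
  *-distribˡₚ p q q' =
    ≈-trans (*-commₚ p _) (≈-trans (*-distribʳₚ q q' p) (+-cong (*-commₚ q p) (*-commₚ q' p)))

  scale-*ˡ : ∀ a q r → (scale a q *ₚ r) ≈ scale a (q *ₚ r)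
  scale-*ˡ a []      r = ≈-refl
  scale-*ˡ a (b ∷ q) r = begin
    scale (a * b) r +ₚ (0# ∷ (scale a q *ₚ r))
      ≈⟨ +-cong (≈-sym (scale-scale a b r)) (∷-cong refl (scale-*ˡ a q r)) ⟩
    scale a (scale b r) +ₚ (0# ∷ scale a (q *ₚ r))
      ≈⟨ +-cong (≈-refl {scale a (scale b r)}) (∷-cong (sym (*-zeroʳ a)) ≈-refl) ⟩
    scale a (scale b r) +ₚ scale a (0# ∷ (q *ₚ r))     ≈⟨ scale-distribˡ a (scale b r) (0# ∷ (q *ₚ r)) ⟨
    scale a (scale b r +ₚ (0# ∷ (q *ₚ r)))             ∎
    where open ≈-Reasoning

  *-assocₚ : ∀ p q r → ((p *ₚ q) *ₚ r) ≈ (p *ₚ (q *ₚ r))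
  *-assocₚ []      q r = ≈-refl
  *-assocₚ (a ∷ p) q r = begin
    (scale a q +ₚ (0# ∷ (p *ₚ q))) *ₚ r                 ≈⟨ *-distribʳₚ (scale a q) (0# ∷ (p *ₚ q)) r ⟩
    (scale a q *ₚ r) +ₚ ((0# ∷ (p *ₚ q)) *ₚ r)          ≈⟨ +-cong (scale-*ˡ a q r) (+-cong (scale-0 r) ≈-refl) ⟩
    scale a (q *ₚ r) +ₚ (0# ∷ ((p *ₚ q) *ₚ r))
      ≈⟨ +-cong (≈-refl {scale a (q *ₚ r)}) (∷-cong refl (*-assocₚ p q r)) ⟩
    scale a (q *ₚ r) +ₚ (0# ∷ (p *ₚ (q *ₚ r)))          ∎
    where open ≈-Reasoning

  *-idˡₚ : ∀ p → (oneₚ *ₚ p) ≈ p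
  *-idˡₚ p = ≈-trans (+-cong (scale-1 p) (0∷-zero ≈-refl)) (+-idʳₚ p)

  *-const : ∀ p c → (p *ₚ (c ∷ [])) ≈ scale c p
  *-const p c = ≈-trans (*-∷ʳ p c []) (≈-trans (+-cong (≈-refl {scale c p}) (0∷-zero (*-zeroʳₚ p))) (+-idʳₚ _))

  ring : CommutativeRing _ _
  ring = record
    { Carrier = Poly A ; _≈_ = _≈_ ; _+_ = _+ₚ_ ; _*_ = _*ₚ_ ; -_ = -ₚ_ ; 0# = [] ; 1# = oneₚ
    ; isCommutativeRing = record
      { isRing = record
        { +-isAbelianGroup = record
          { isGroup = record
            { isMonoid = record
              { isSemigroup = record
                { isMagma = record { isEquivalence = Setoid.isEquivalence setoid ; ∙-cong = +-cong }
                ; assoc = +-assocₚ }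
              ; identity = (λ p → ≈-refl) , +-idʳₚ }
            ; inverse = -‿invˡₚ , (λ p → ≈-trans (+-commₚ p (-ₚ p)) (-‿invˡₚ p))
            ; ⁻¹-cong = -‿cong }
          ; comm = +-commₚ }
        ; *-cong = *-cong
        ; *-assoc = *-assocₚ
        ; *-identity = *-idˡₚ , (λ p → ≈-trans (*-commₚ p oneₚ) (*-idˡₚ p))
        ; distrib = *-distribˡₚ , (λ p q q' → *-distribʳₚ q q' p) }
      ; *-comm = *-commₚ }
    }

  -- Identities of A[x] are proved with `solve` from the ring solver (with
  -- natural-number coefficients, so that it works for an arbitrary A).
  open import Algebra.Solver.Ring.NaturalCoefficients.Default (CommutativeRing.commutativeSemiring ring) public
    using (solve; _:=_; _:+_; _:*_)

  coprime-* : ∀ {a c g} → Coprime a g → Coprime g c → Coprime (a *ₚ c) g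
  coprime-* {a} {c} {g} (u₁ , v₁ , e₁) (u₂ , v₂ , e₂) = v₂ *ₚ u₁ , u₂ +ₚ (v₂ *ₚ (v₁ *ₚ c)) , get (begin
    ((v₂ *ₚ u₁) *ₚ (a *ₚ c)) +ₚ ((u₂ +ₚ (v₂ *ₚ (v₁ *ₚ c))) *ₚ g)   ≈⟨ regroup ⟩
    (u₂ *ₚ g) +ₚ (v₂ *ₚ ((u₁ *ₚ (a *ₚ c)) +ₚ ((v₁ *ₚ c) *ₚ g)))    ≈⟨ +-cong (≈-refl {u₂ *ₚ g}) (*-congʳ v₂ c≈) ⟨
    (u₂ *ₚ g) +ₚ (v₂ *ₚ c)                                          ≈⟨ mk e₂ ⟩
    oneₚ                                                            ∎)
    where
    open ≈-Reasoning
    u₁a+v₁g≈1 : ((u₁ *ₚ a) +ₚ (v₁ *ₚ g)) ≈ oneₚ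
    u₁a+v₁g≈1 = mk e₁
    c≈ : c ≈ ((u₁ *ₚ (a *ₚ c)) +ₚ ((v₁ *ₚ c) *ₚ g))
    c≈ = begin
      c                                      ≈⟨ *-idˡₚ c ⟨
      oneₚ *ₚ c                              ≈⟨ *-congˡ c u₁a+v₁g≈1 ⟨
      ((u₁ *ₚ a) +ₚ (v₁ *ₚ g)) *ₚ c
        ≈⟨ solve 5 (λ u₁ a v₁ g c → (u₁ :* a :+ v₁ :* g) :* c := u₁ :* (a :* c) :+ v₁ :* c :* g)
                   ≈-refl u₁ a v₁ g c ⟩
      (u₁ *ₚ (a *ₚ c)) +ₚ ((v₁ *ₚ c) *ₚ g)   ∎
    regroup : (((v₂ *ₚ u₁) *ₚ (a *ₚ c)) +ₚ ((u₂ +ₚ (v₂ *ₚ (v₁ *ₚ c))) *ₚ g))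
              ≈ ((u₂ *ₚ g) +ₚ (v₂ *ₚ ((u₁ *ₚ (a *ₚ c)) +ₚ ((v₁ *ₚ c) *ₚ g))))
    regroup = solve 7 (λ v₂ u₁ a c u₂ v₁ g →
      (((v₂ :* u₁) :* (a :* c)) :+ ((u₂ :+ (v₂ :* (v₁ :* c))) :* g))
        := ((u₂ :* g) :+ (v₂ :* ((u₁ :* (a :* c)) :+ ((v₁ :* c) :* g))))) ≈-refl v₂ u₁ a c u₂ v₁ g

  coprime-∣ : ∀ {a g l} → Coprime a g → g ∣ₚ (l *ₚ a) → g ∣ₚ l
  coprime-∣ {a} {g} {l} (u , v , e) (q , gq≈la) = (u *ₚ q) +ₚ (l *ₚ v) , get (begin
    g *ₚ ((u *ₚ q) +ₚ (l *ₚ v))                   ≈⟨ regroup ⟩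
    (u *ₚ (g *ₚ q)) +ₚ ((l *ₚ v) *ₚ g)            ≈⟨ +-cong (*-congʳ u (mk gq≈la)) (≈-refl {(l *ₚ v) *ₚ g}) ⟩
    (u *ₚ (l *ₚ a)) +ₚ ((l *ₚ v) *ₚ g)            ≈⟨ factor ⟩
    l *ₚ ((u *ₚ a) +ₚ (v *ₚ g))                   ≈⟨ *-congʳ l (mk e) ⟩
    l *ₚ oneₚ                                     ≈⟨ ≈-trans (*-commₚ l oneₚ) (*-idˡₚ l) ⟩
    l                                             ∎)
    where
    open ≈-Reasoning
    regroup : (g *ₚ ((u *ₚ q) +ₚ (l *ₚ v))) ≈ ((u *ₚ (g *ₚ q)) +ₚ ((l *ₚ v) *ₚ g))
    regroup = solve 5 (λ g u q l v → g :* (u :* q :+ l :* v) := u :* (g :* q) :+ l :* v :* g) ≈-refl g u q l v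
    factor : ((u *ₚ (l *ₚ a)) +ₚ ((l *ₚ v) *ₚ g)) ≈ (l *ₚ ((u *ₚ a) +ₚ (v *ₚ g)))
    factor = solve 5 (λ u l a v g → u :* (l :* a) :+ l :* v :* g := l :* (u :* a :+ v :* g)) ≈-refl u l a v g

module Reduction {A : Set} {0# 1# : A} {_+_ _*_ : A → A → A} { -_ : A → A}
                 (laws : CommRingLaws 0# 1# _+_ _*_ -_) where
  open CommRingLaws laws
  open Polynomials laws
  open PolyOps 0# 1# _+_ _*_

  _+ᵥ_ : ∀ {n} → Vec A n → Vec A n → Vec A n
  _+ᵥ_ = zipWith _+_

  0ᵥ : ∀ n → Vec A n
  0ᵥ n = replicate n 0#

  +ᵥ-idˡ : ∀ {n} (v : Vec A n) → 0ᵥ n +ᵥ v ≡ v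
  +ᵥ-idˡ []      = refl
  +ᵥ-idˡ (x ∷ v) = cong₂ _∷_ (+-idˡ x) (+ᵥ-idˡ v)

  +ᵥ-idʳ : ∀ {n} (v : Vec A n) → v +ᵥ 0ᵥ n ≡ v
  +ᵥ-idʳ []      = refl
  +ᵥ-idʳ (x ∷ v) = cong₂ _∷_ (+-idʳ x) (+ᵥ-idʳ v)

  lastOf-+ᵥ : ∀ {n} x y (xs ys : Vec A n) → lastOf (x + y) (xs +ᵥ ys) ≡ lastOf x xs + lastOf y ys
  lastOf-+ᵥ x y []        []        = refl
  lastOf-+ᵥ x y (x' ∷ xs) (y' ∷ ys) = lastOf-+ᵥ x' y' xs ys

  dropLast-+ᵥ : ∀ {n} x y (xs ys : Vec A n) → dropLast (x + y) (xs +ᵥ ys) ≡ dropLast x xs +ᵥ dropLast y ys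
  dropLast-+ᵥ x y []        []        = refl
  dropLast-+ᵥ x y (x' ∷ xs) (y' ∷ ys) = cong ((x + y) ∷_) (dropLast-+ᵥ x' y' xs ys)

  rot-+ᵥ : ∀ {n} (u w : Vec A n) → rot (u +ᵥ w) ≡ rot u +ᵥ rot w
  rot-+ᵥ []       []       = refl
  rot-+ᵥ (x ∷ xs) (y ∷ ys) = cong₂ _∷_ (lastOf-+ᵥ x y xs ys) (dropLast-+ᵥ x y xs ys)

  addConst-+ᵥ : ∀ {n} a b (u w : Vec A n) → addConst (a + b) (u +ᵥ w) ≡ addConst a u +ᵥ addConst b w
  addConst-+ᵥ a b []       []       = refl
  addConst-+ᵥ a b (x ∷ xs) (y ∷ ys) = cong (_∷ (xs +ᵥ ys)) (begin
    (a + b) + (x + y)   ≡⟨ +-assoc a b (x + y) ⟩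
    a + (b + (x + y))   ≡⟨ cong (a +_) (+-assoc b x y) ⟨
    a + ((b + x) + y)   ≡⟨ cong (λ z → a + (z + y)) (+-comm b x) ⟩
    a + ((x + b) + y)   ≡⟨ cong (a +_) (+-assoc x b y) ⟩
    a + (x + (b + y))   ≡⟨ +-assoc a x (b + y) ⟨
    (a + x) + (b + y)   ∎)
    where open ≡-Reasoning

  reduce-+ : ∀ n p q → reduce n (p +ₚ q) ≡ reduce n p +ᵥ reduce n q
  reduce-+ n []      q       = sym (+ᵥ-idˡ _)
  reduce-+ n (a ∷ p) []      = sym (+ᵥ-idʳ _)
  reduce-+ n (a ∷ p) (b ∷ q) = begin
    addConst (a + b) (rot (reduce n (p +ₚ q)))
      ≡⟨ cong (λ v → addConst (a + b) (rot v)) (reduce-+ n p q) ⟩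
    addConst (a + b) (rot (reduce n p +ᵥ reduce n q))
      ≡⟨ cong (addConst (a + b)) (rot-+ᵥ (reduce n p) (reduce n q)) ⟩
    addConst (a + b) (rot (reduce n p) +ᵥ rot (reduce n q))    ≡⟨ addConst-+ᵥ a b _ _ ⟩
    addConst a (rot (reduce n p)) +ᵥ addConst b (rot (reduce n q)) ∎
    where open ≡-Reasoning

  lastOf-0ᵥ : ∀ n → lastOf 0# (0ᵥ n) ≡ 0#
  lastOf-0ᵥ zero    = refl
  lastOf-0ᵥ (suc n) = lastOf-0ᵥ n

  dropLast-0ᵥ : ∀ n → dropLast 0# (0ᵥ n) ≡ 0ᵥ n
  dropLast-0ᵥ zero    = refl
  dropLast-0ᵥ (suc n) = cong (0# ∷_) (dropLast-0ᵥ n)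

  reduce-zero : ∀ n {p} → p ≈ [] → reduce n p ≡ 0ᵥ n
  reduce-zero n {[]}    e = refl
  reduce-zero n {a ∷ p} e with ∷-zero-inv e
  ... | refl , p≈0 = begin
    addConst 0# (rot (reduce n p))  ≡⟨ cong (λ v → addConst 0# (rot v)) (reduce-zero n p≈0) ⟩
    addConst 0# (rot (0ᵥ n))        ≡⟨ cong (addConst 0#) (rot-0ᵥ n) ⟩
    addConst 0# (0ᵥ n)              ≡⟨ addConst-0 (0ᵥ n) ⟩
    0ᵥ n                            ∎
    where
    open ≡-Reasoning
    rot-0ᵥ : ∀ n → rot (0ᵥ n) ≡ 0ᵥ n
    rot-0ᵥ zero    = refl
    rot-0ᵥ (suc n) = cong₂ _∷_ (lastOf-0ᵥ n) (dropLast-0ᵥ n)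
    addConst-0 : ∀ {n} (v : Vec A n) → addConst 0# v ≡ v
    addConst-0 []      = refl
    addConst-0 (x ∷ v) = cong (_∷ v) (+-idˡ x)

  reduce-cong : ∀ n {p q} → p ≈ q → reduce n p ≡ reduce n q
  reduce-cong n {[]}    {q}     e = sym (reduce-zero n (≈-sym e))
  reduce-cong n {a ∷ p} {[]}    e = reduce-zero n e
  reduce-cong n {a ∷ p} {b ∷ q} e with ∷-injective e
  ... | refl , p≈q = cong (λ v → addConst a (rot v)) (reduce-cong n p≈q)

  reduce-scale : ∀ n a q → reduce n (scale a q) ≡ V.map (a *_) (reduce n q)
  reduce-scale n a = CoefficientMap.reduce-map {0a = 0#} {1#} {_+_} {_*_} {0#} {1#} {_+_} {_*_}
                       (a *_) (*-zeroʳ a) (distribˡ a) n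

  reduce-*-congˡ : ∀ n l {q q'} → reduce n q ≡ reduce n q' → reduce n (l *ₚ q) ≡ reduce n (l *ₚ q')
  reduce-*-congˡ n []      e = refl
  reduce-*-congˡ n (a ∷ l) {q} {q'} e = begin
    reduce n (scale a q +ₚ (0# ∷ (l *ₚ q)))                        ≡⟨ reduce-+ n (scale a q) (0# ∷ (l *ₚ q)) ⟩
    reduce n (scale a q) +ᵥ addConst 0# (rot (reduce n (l *ₚ q)))    ≡⟨ cong₂ _+ᵥ_ scaled shifted ⟩
    reduce n (scale a q') +ᵥ addConst 0# (rot (reduce n (l *ₚ q')))  ≡⟨ reduce-+ n (scale a q') (0# ∷ (l *ₚ q')) ⟨
    reduce n (scale a q' +ₚ (0# ∷ (l *ₚ q')))                      ∎
    where
    open ≡-Reasoning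
    scaled : reduce n (scale a q) ≡ reduce n (scale a q')
    scaled = trans (reduce-scale n a q) (trans (cong (V.map (a *_)) e) (sym (reduce-scale n a q')))
    shifted : addConst 0# (rot (reduce n (l *ₚ q))) ≡ addConst 0# (rot (reduce n (l *ₚ q')))
    shifted = cong (λ v → addConst 0# (rot v)) (reduce-*-congˡ n l e)

  pad : List A → (n : ℕ) → Vec A n
  pad []      n       = 0ᵥ n
  pad (x ∷ L) zero    = []
  pad (x ∷ L) (suc n) = x ∷ pad L n

  rot-pad : ∀ x L n → suc (length L) ≤ n →
            (lastOf x (pad L n) ≡ 0#) × (dropLast x (pad L n) ≡ pad (x ∷ L) n)
  rot-pad x []      (suc m) le       = lastOf-0ᵥ m , cong (x ∷_) (dropLast-0ᵥ m)
  rot-pad x (y ∷ L) (suc m) (s≤s le) = proj₁ (rot-pad y L m le) , cong (x ∷_) (proj₂ (rot-pad y L m le))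

  reduce-pad : ∀ L n → length L ≤ n → reduce n L ≡ pad L n
  reduce-pad []          n       le       = refl
  reduce-pad (x ∷ [])    (suc m) le       =
    cong₂ _∷_ (trans (cong (x +_) (lastOf-0ᵥ m)) (+-idʳ x)) (dropLast-0ᵥ m)
  reduce-pad (x ∷ y ∷ L) (suc m) (s≤s le) = begin
    addConst x (rot (reduce (suc m) (y ∷ L)))
      ≡⟨ cong (λ v → addConst x (rot v)) (reduce-pad (y ∷ L) (suc m) (m≤n⇒m≤1+n le)) ⟩
    addConst x (rot (y ∷ pad L m))
      ≡⟨ cong₂ _∷_ (trans (cong (x +_) (proj₁ (rot-pad y L m le))) (+-idʳ x)) (proj₂ (rot-pad y L m le)) ⟩
    x ∷ pad (y ∷ L) m                           ∎
    where open ≡-Reasoning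

  reduce-toList : ∀ {n} (v : Vec A n) → reduce n (toList v) ≡ v
  reduce-toList {n} v =
    trans (reduce-pad (toList v) n (subst (_≤ n) (sym (length-toList v)) ≤-refl)) (pad-toList v)
    where
    pad-toList : ∀ {n} (v : Vec A n) → pad (toList v) n ≡ v
    pad-toList []      = refl
    pad-toList (x ∷ v) = cong (x ∷_) (pad-toList v)

  reduce-*-toList : ∀ n l q → reduce n (l *ₚ toList (reduce n q)) ≡ reduce n (l *ₚ q)
  reduce-*-toList n l q = reduce-*-congˡ n l (reduce-toList (reduce n q))

  xPow : ℕ → Poly A
  xPow zero    = 1# ∷ []
  xPow (suc k) = 0# ∷ xPow k

  X : ℕ → Poly A
  X n = xⁿ-1 (- 1#) n

  xⁿ-1-suc : ∀ m1 k → xⁿ-1 m1 (suc k) ≡ m1 ∷ xPow k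
  xⁿ-1-suc m1 zero    = refl
  xⁿ-1-suc m1 (suc k) = cong (λ l → m1 ∷ 0# ∷ tail l) (xⁿ-1-suc m1 k)
    where
    tail : List A → List A
    tail []      = []
    tail (x ∷ l) = l

  reduce-X : ∀ n → reduce n (X n) ≡ 0ᵥ n
  reduce-X zero    = refl
  reduce-X (suc k) = begin
    reduce (suc k) (X (suc k))            ≡⟨ cong (reduce (suc k)) (xⁿ-1-suc (- 1#) k) ⟩
    addConst (- 1#) (rot (reduce (suc k) (xPow k)))
      ≡⟨ cong (λ v → addConst (- 1#) (rot v))
              (reduce-pad (xPow k) (suc k) (subst (_≤ suc k) (sym (length-xPow k)) ≤-refl)) ⟩
    addConst (- 1#) (rot (pad (xPow k) (suc k)))  ≡⟨ cong (addConst (- 1#)) (rot-xPow k) ⟩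
    addConst (- 1#) (1# ∷ 0ᵥ k)           ≡⟨ cong (_∷ 0ᵥ k) (-‿invˡ 1#) ⟩
    0ᵥ (suc k)                            ∎
    where
    open ≡-Reasoning
    length-xPow : ∀ k → length (xPow k) ≡ suc k
    length-xPow zero    = refl
    length-xPow (suc k) = cong suc (length-xPow k)
    rot-xPow-aux : ∀ x k → (lastOf x (pad (xPow k) (suc k)) ≡ 1#) × (dropLast x (pad (xPow k) (suc k)) ≡ x ∷ 0ᵥ k)
    rot-xPow-aux x zero    = refl , refl
    rot-xPow-aux x (suc k) = proj₁ (rot-xPow-aux 0# k) , cong (x ∷_) (proj₂ (rot-xPow-aux 0# k))
    rot-xPow : ∀ k → rot (pad (xPow k) (suc k)) ≡ 1# ∷ 0ᵥ k
    rot-xPow zero    = refl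
    rot-xPow (suc k) = cong₂ _∷_ (proj₁ (rot-xPow-aux 0# k)) (proj₂ (rot-xPow-aux 0# k))

  reduce-multiple : ∀ n {Y} → Y ≈ X n → ∀ q → reduce n (Y *ₚ q) ≡ 0ᵥ n
  reduce-multiple n {Y} Y≈X q = begin
    reduce n (Y *ₚ q)          ≡⟨ reduce-cong n (*-commₚ Y q) ⟩
    reduce n (q *ₚ Y)          ≡⟨ reduce-*-congˡ n q {q' = []} (trans (reduce-cong n Y≈X) (reduce-X n)) ⟩
    reduce n (q *ₚ [])         ≡⟨ reduce-zero n (*-zeroʳₚ q) ⟩
    0ᵥ n                       ∎
    where open ≡-Reasoning

  reduce-+-multiple : ∀ n {Y} → Y ≈ X n → ∀ p q → reduce n (p +ₚ (Y *ₚ q)) ≡ reduce n p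
  reduce-+-multiple n {Y} Y≈X p q = begin
    reduce n (p +ₚ (Y *ₚ q))               ≡⟨ reduce-+ n p (Y *ₚ q) ⟩
    reduce n p +ᵥ reduce n (Y *ₚ q)        ≡⟨ cong (reduce n p +ᵥ_) (reduce-multiple n Y≈X q) ⟩
    reduce n p +ᵥ 0ᵥ n                     ≡⟨ +ᵥ-idʳ (reduce n p) ⟩
    reduce n p                             ∎
    where open ≡-Reasoning

  toList-0ᵥ : ∀ n → toList (0ᵥ n) ≈ []
  toList-0ᵥ zero    = ≈-refl
  toList-0ᵥ (suc n) = 0∷-zero (toList-0ᵥ n)

  split-top : ∀ {m} y (ys : Vec A m) → (y ∷ toList ys) ≈ (scale (lastOf y ys) (xPow m) +ₚ toList (dropLast y ys))
  split-top y []       = ∷-cong (sym (trans (*-comm y 1#) (*-idˡ y))) ≈-refl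
  split-top y (z ∷ zs) = ∷-cong (sym (trans (cong (_+ y) (*-zeroʳ _)) (+-idˡ y))) (split-top z zs)

  *-neg-one-cancel : ∀ c → (c * (- 1#)) + c ≡ 0#
  *-neg-one-cancel c = begin
    (c * (- 1#)) + c          ≡⟨ cong ((c * (- 1#)) +_) (trans (*-comm c 1#) (*-idˡ c)) ⟨
    (c * (- 1#)) + (c * 1#)   ≡⟨ distribˡ c (- 1#) 1# ⟨
    c * ((- 1#) + 1#)         ≡⟨ cong (c *_) (-‿invˡ 1#) ⟩
    c * 0#                    ≡⟨ *-zeroʳ c ⟩
    0#                        ∎
    where open ≡-Reasoning

  x*vector : ∀ {m} y (ys : Vec A m) →
             (0# ∷ y ∷ toList ys) ≈ ((X (suc m) *ₚ (lastOf y ys ∷ [])) +ₚ toList (rot (y ∷ ys)))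
  x*vector {m} y ys = ≈-sym (begin
    (X (suc m) *ₚ (c ∷ [])) +ₚ (c ∷ toList (dropLast y ys))
      ≈⟨ +-cong {q = c ∷ toList (dropLast y ys)}
                (≈-trans (*-const (X (suc m)) c) (≡⇒≈ (cong (scale c) (xⁿ-1-suc (- 1#) m)))) ≈-refl ⟩
    ((c * (- 1#)) + c) ∷ (scale c (xPow m) +ₚ toList (dropLast y ys))
      ≈⟨ ∷-cong (*-neg-one-cancel c) (≈-sym (split-top y ys)) ⟩
    0# ∷ y ∷ toList ys ∎)
    where
    open ≈-Reasoning
    c : A
    c = lastOf y ys

  top : ∀ {k} → Vec A (suc k) → A
  top (y ∷ ys) = lastOf y ys

  -- if p ≡ r mod xⁿ - 1 then c + x·p ≡ c + x·r, and c + x·r is reduced by rotating r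
  division-step : ∀ {k} c p q (r : Vec A (suc k)) → p ≈ ((X (suc k) *ₚ q) +ₚ toList r) →
                  (c ∷ p) ≈ ((X (suc k) *ₚ ((0# ∷ q) +ₚ (top r ∷ []))) +ₚ toList (addConst c (rot r)))
  division-step {k} c p q (y ∷ ys) p≈ = begin
    c ∷ p                                               ≈⟨ ∷-cong (sym (+-idʳ c)) p≈ ⟩
    C +ₚ (0# ∷ ((Xn *ₚ q) +ₚ V))                        ≈⟨ +-cong (≈-refl {C}) (∷-cong (sym (+-idˡ 0#)) ≈-refl) ⟩
    C +ₚ ((0# ∷ (Xn *ₚ q)) +ₚ (0# ∷ V))                 ≈⟨ +-cong (≈-refl {C}) (+-cong x*Xq (x*vector y ys)) ⟩
    C +ₚ ((Xn *ₚ (0# ∷ q)) +ₚ ((Xn *ₚ T) +ₚ W))         ≈⟨ rearrange ⟩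
    (Xn *ₚ ((0# ∷ q) +ₚ T)) +ₚ (C +ₚ W)                 ∎
    where
    open ≈-Reasoning
    Xn C V T W : Poly A
    Xn = X (suc k)
    C  = c ∷ []
    V  = y ∷ toList ys
    T  = lastOf y ys ∷ []
    W  = toList (rot (y ∷ ys))
    x*Xq : (0# ∷ (Xn *ₚ q)) ≈ (Xn *ₚ (0# ∷ q))
    x*Xq = ≈-sym (≈-trans (*-∷ʳ Xn 0# q) (+-cong (scale-0 Xn) ≈-refl))
    rearrange : (C +ₚ ((Xn *ₚ (0# ∷ q)) +ₚ ((Xn *ₚ T) +ₚ W))) ≈ ((Xn *ₚ ((0# ∷ q) +ₚ T)) +ₚ (C +ₚ W))
    rearrange = solve 5 (λ C X Q T W → (C :+ ((X :* Q) :+ ((X :* T) :+ W))) := ((X :* (Q :+ T)) :+ (C :+ W)))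
                        ≈-refl C Xn (0# ∷ q) T W

  division : ∀ k p → Σ (Poly A) λ q → p ≈ ((X (suc k) *ₚ q) +ₚ toList (reduce (suc k) p))
  division k []      = [] , ≈-sym (+-cong (*-zeroʳₚ (X (suc k))) (toList-0ᵥ (suc k)))
  division k (c ∷ p) with division k p
  ... | q , p≈ = (0# ∷ q) +ₚ (top (reduce (suc k) p) ∷ []) , division-step c p q (reduce (suc k) p) p≈

  reduce≡0⇒multiple : ∀ k p → reduce (suc k) p ≡ 0ᵥ (suc k) → Σ (Poly A) λ q → p ≈ (X (suc k) *ₚ q)
  reduce≡0⇒multiple k p p↦0 with division k p
  ... | q , p≈ = q , ≈-trans p≈ (≈-trans (+-cong (≈-refl {X (suc k) *ₚ q}) remainder≈0) (+-idʳₚ _))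
    where
    remainder≈0 : toList (reduce (suc k) p) ≈ []
    remainder≈0 = ≈-trans (≡⇒≈ (cong toList p↦0)) (toList-0ᵥ (suc k))

module Z₂x  = Polynomials Z₂-laws
module Z₄x  = Polynomials Z₄-laws
module Red₂ = Reduction Z₂-laws
module Red₄ = Reduction Z₄-laws

open P₂ using () renaming (_+ₚ_ to infixl 6 _+²_; _*ₚ_ to infixl 7 _*²_)
open P₄ using () renaming (_+ₚ_ to infixl 6 _+⁴_; _*ₚ_ to infixl 7 _*⁴_)
open Z₂x using () renaming (_≈_ to _≈²_)
open Z₄x using () renaming (_≈_ to _≈⁴_)

private
  module Mod2 = CoefficientMap {0a = 0₄} {1₄} {_+₄_} {_*₄_} {0₂} {1₂} {_+₂_} {_*₂_} red₂ refl red₂-+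

mod2-+ : ∀ p q → mod2 (p +⁴ q) ≡ mod2 p +² mod2 q
mod2-+ = Mod2.map-+

mod2-* : ∀ p q → mod2 (p *⁴ q) ≡ mod2 p *² mod2 q
mod2-* = Mod2.Multiplicative.map-* red₂-*

mod2-cong : ∀ {p q} → p ≈⁴ q → mod2 p ≈² mod2 q
mod2-cong {p} {q} p≈q = Z₂x.mk (Mod2.map-cong {p} {q} (Z₄x.get p≈q))

mod2-reduce : ∀ n p → P₂.reduce n (mod2 p) ≡ V.map red₂ (P₄.reduce n p)
mod2-reduce = Mod2.reduce-map

mod2-X : ∀ n → mod2 (Red₄.X n) ≡ Red₂.X n
mod2-X zero    = refl
mod2-X (suc k) = begin
  mod2 (Red₄.X (suc k))     ≡⟨ cong mod2 (Red₄.xⁿ-1-suc 3₄ k) ⟩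
  1₂ ∷ mod2 (Red₄.xPow k)   ≡⟨ cong (1₂ ∷_) (mod2-xPow k) ⟩
  1₂ ∷ Red₂.xPow k          ≡⟨ Red₂.xⁿ-1-suc 1₂ k ⟨
  Red₂.X (suc k)            ∎
  where
  open ≡-Reasoning
  mod2-xPow : ∀ k → mod2 (Red₄.xPow k) ≡ Red₂.xPow k
  mod2-xPow zero    = refl
  mod2-xPow (suc k) = cong (0₂ ∷_) (mod2-xPow k)

mod2-coprime : ∀ {p q} → P₄.Coprime p q → P₂.Coprime (mod2 p) (mod2 q)
mod2-coprime {p} {q} (u , v , e) = mod2 u , mod2 v , Z₂x.get (begin
  mod2 u *² mod2 p +² mod2 v *² mod2 q   ≈⟨ Z₂x.≡⇒≈ (cong₂ _+²_ (mod2-* u p) (mod2-* v q)) ⟨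
  mod2 (u *⁴ p) +² mod2 (v *⁴ q)         ≈⟨ Z₂x.≡⇒≈ (mod2-+ (u *⁴ p) (v *⁴ q)) ⟨
  mod2 (u *⁴ p +⁴ v *⁴ q)                ≈⟨ mod2-cong {q = P₄.oneₚ} (Z₄x.mk e) ⟩
  P₂.oneₚ                                ∎)
  where open SetoidReasoning Z₂x.setoid

2·-as-product : ∀ p → (2₄ ∷ []) *⁴ p ≈⁴ 2· p
2·-as-product p = Z₄x.≈-trans (Z₄x.*-commₚ (2₄ ∷ []) p) (Z₄x.*-const p 2₄)

2·2≈0 : (2₄ ∷ []) *⁴ (2₄ ∷ []) ≈⁴ []
2·2≈0 = Z₄x.0∷-zero Z₄x.≈-refl

mod2-2· : ∀ p → mod2 (2· p) ≈² []
mod2-2· []      = Z₂x.≈-refl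
mod2-2· (a ∷ p) = subst (λ c → c ∷ mod2 (2· p) ≈² []) (sym (even a)) (Z₂x.0∷-zero (mod2-2· p))
  where
  even : ∀ a → red₂ (2₄ *₄ a) ≡ 0₂
  even = every₄ refl refl refl refl

half : Z₄ → Z₄
half 0₄ = 0₄
half 1₄ = 0₄
half 2₄ = 1₄
half 3₄ = 1₄

mod2≈0⇒2·half : ∀ d → mod2 d ≈² [] → d ≈⁴ 2· (map half d)
mod2≈0⇒2·half d d↦0 = Z₄x.mk λ i → begin
  P₄.coeff d i                    ≡⟨ twice-half (P₄.coeff d i) (trans (sym (Mod2.coeff-map d i)) (Z₂x.get d↦0 i)) ⟩
  2₄ *₄ half (P₄.coeff d i)       ≡⟨ cong (2₄ *₄_) (Z₄x.coeff-map half refl d i) ⟨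
  2₄ *₄ P₄.coeff (map half d) i   ≡⟨ Z₄x.coeff-scale 2₄ (map half d) i ⟨
  P₄.coeff (2· (map half d)) i    ∎
  where
  open ≡-Reasoning
  twice-half : ∀ x → red₂ x ≡ 0₂ → x ≡ 2₄ *₄ half x
  twice-half 0₄ _ = refl
  twice-half 1₄ ()
  twice-half 2₄ _ = refl
  twice-half 3₄ ()

lift : Z₂ → Z₄
lift 0₂ = 0₄
lift 1₂ = 1₄

mod2-lift : ∀ m → mod2 (map lift m) ≡ m
mod2-lift []       = refl
mod2-lift (0₂ ∷ m) = cong (0₂ ∷_) (mod2-lift m)
mod2-lift (1₂ ∷ m) = cong (1₂ ∷_) (mod2-lift m)

mod2-neg : ∀ p → mod2 (Z₄x.-ₚ p) ≡ mod2 p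
mod2-neg []      = refl
mod2-neg (a ∷ p) = cong₂ _∷_ (every₄ {λ x → red₂ (3₄ *₄ x) ≡ red₂ x} refl refl refl refl a) (mod2-neg p)

+-self₂ : ∀ p → p +² p ≈² []
+-self₂ p = Z₂x.mk λ i → trans (Z₂x.coeff-+ p p i) (every₂ {λ x → x +₂ x ≡ 0₂} refl refl (P₂.coeff p i))

mod2-difference : ∀ l g m → mod2 l ≈² mod2 g *² m → mod2 (l +⁴ Z₄x.-ₚ (g *⁴ map lift m)) ≈² []
mod2-difference l g m l≡gm = begin
  mod2 (l +⁴ Z₄x.-ₚ gμ)           ≈⟨ Z₂x.≡⇒≈ (trans (mod2-+ l (Z₄x.-ₚ gμ)) (cong (mod2 l +²_) (mod2-neg gμ))) ⟩
  mod2 l +² mod2 gμ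
    ≈⟨ Z₂x.+-cong l≡gm (Z₂x.≡⇒≈ (trans (mod2-* g μ) (cong (mod2 g *²_) (mod2-lift m)))) ⟩
  mod2 g *² m +² mod2 g *² m      ≈⟨ +-self₂ (mod2 g *² m) ⟩
  []                              ∎
  where
  open SetoidReasoning Z₂x.setoid
  μ gμ : Poly Z₄
  μ  = map lift m
  gμ = g *⁴ μ

mod2-factor⇒split : ∀ l g m → mod2 l ≈² mod2 g *² m →
                    Σ (Poly Z₄) λ μ → Σ (Poly Z₄) λ ν → l ≈⁴ g *⁴ μ +⁴ 2· ν
mod2-factor⇒split l g m l≡gm = μ , map half d , (begin
  l                          ≈⟨ Z₄x.+-cong (Z₄x.-‿invˡₚ gμ) (Z₄x.≈-refl {l}) ⟨
  Z₄x.-ₚ gμ +⁴ gμ +⁴ l       ≈⟨ Z₄x.+-cong (Z₄x.+-commₚ (Z₄x.-ₚ gμ) gμ) (Z₄x.≈-refl {l}) ⟩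
  gμ +⁴ Z₄x.-ₚ gμ +⁴ l       ≈⟨ Z₄x.+-assocₚ gμ (Z₄x.-ₚ gμ) l ⟩
  gμ +⁴ (Z₄x.-ₚ gμ +⁴ l)     ≈⟨ Z₄x.+-cong (Z₄x.≈-refl {gμ}) (Z₄x.+-commₚ (Z₄x.-ₚ gμ) l) ⟩
  gμ +⁴ d                    ≈⟨ Z₄x.+-cong (Z₄x.≈-refl {gμ}) (mod2≈0⇒2·half d (mod2-difference l g m l≡gm)) ⟩
  gμ +⁴ 2· (map half d)      ∎)
  where
  open SetoidReasoning Z₄x.setoid
  μ gμ d : Poly Z₄
  μ  = map lift m
  gμ = g *⁴ μ
  d  = l +⁴ Z₄x.-ₚ gμ

order2⇒even : ∀ {n} (u : Vec Z₄ n) → u Red₄.+ᵥ u ≡ Red₄.0ᵥ n → V.map red₂ u ≡ Red₂.0ᵥ n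
order2⇒even []      _ = refl
order2⇒even (x ∷ u) e = cong₂ _∷_ (even x (cong V.head e)) (order2⇒even u (cong V.tail e))
  where
  even : ∀ x → x +₄ x ≡ 0₄ → red₂ x ≡ 0₂
  even 0₄ _ = refl
  even 1₄ ()
  even 2₄ _ = refl
  even 3₄ ()

order2-Z₂ : ∀ {n} (u : Vec Z₂ n) → u Red₂.+ᵥ u ≡ Red₂.0ᵥ n
order2-Z₂ []      = refl
order2-Z₂ (x ∷ u) = cong₂ _∷_ (every₂ {λ x → x +₂ x ≡ 0₂} refl refl x) (order2-Z₂ u)

order2-double : ∀ {n} (u : Vec Z₄ n) → V.map (2₄ *₄_) u Red₄.+ᵥ V.map (2₄ *₄_) u ≡ Red₄.0ᵥ n
order2-double []      = refl
order2-double (x ∷ u) =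
  cong₂ _∷_ (every₄ {λ x → (2₄ *₄ x) +₄ (2₄ *₄ x) ≡ 0₄} refl refl refl refl x) (order2-double u)

module _ {α β : ℕ} where

  ⋆-[] : ∀ l p q → _≡_ {A = R α β} (l ⋆ [ p ∣ q ]) [ mod2 l *² p ∣ l *⁴ q ]
  ⋆-[] l p q = cong₂ ⟪_∣_⟫ (Red₂.reduce-*-toList α (mod2 l) p) (Red₄.reduce-*-toList β l q)

  +R-[] : ∀ p q p' q' → _≡_ {A = R α β} ([ p ∣ q ] +R [ p' ∣ q' ]) [ p +² p' ∣ q +⁴ q' ]
  +R-[] p q p' q' = cong₂ ⟪_∣_⟫ (sym (Red₂.reduce-+ α p p')) (sym (Red₄.reduce-+ β q q'))

  ⋆+⋆-[] : ∀ l₁ l₂ p₁ q₁ p₂ q₂ → _≡_ {A = R α β} ((l₁ ⋆ [ p₁ ∣ q₁ ]) +R (l₂ ⋆ [ p₂ ∣ q₂ ]))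
                                   [ mod2 l₁ *² p₁ +² mod2 l₂ *² p₂ ∣ l₁ *⁴ q₁ +⁴ l₂ *⁴ q₂ ]
  ⋆+⋆-[] l₁ l₂ p₁ q₁ p₂ q₂ = trans (cong₂ _+R_ (⋆-[] l₁ p₁ q₁) (⋆-[] l₂ p₂ q₂))
                                   (+R-[] (mod2 l₁ *² p₁) (l₁ *⁴ q₁) (mod2 l₂ *² p₂) (l₂ *⁴ q₂))

  []-cong : ∀ {p p'} q q' → p ≈² p' → P₄.reduce β q ≡ P₄.reduce β q' → _≡_ {A = R α β} [ p ∣ q ] [ p' ∣ q' ]
  []-cong q q' p≈p' q≡q' = cong₂ ⟪_∣_⟫ (Red₂.reduce-cong α p≈p') q≡q'

  ⋆-congˡ : ∀ {l l'} (v : R α β) → l ≈⁴ l' → l ⋆ v ≡ l' ⋆ v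
  ⋆-congˡ ⟪ u ∣ u' ⟫ l≈l' = cong₂ ⟪_∣_⟫ (Red₂.reduce-cong α (Z₂x.*-congˡ (toList u) (mod2-cong l≈l')))
                                        (Red₄.reduce-cong β (Z₄x.*-congˡ (toList u') l≈l'))

  +R-identityʳ : ∀ (v : R α β) → v +R 0R ≡ v
  +R-identityʳ ⟪ u ∣ u' ⟫ = cong₂ ⟪_∣_⟫ (Red₂.+ᵥ-idʳ u) (Red₄.+ᵥ-idʳ u')

  ∈⟨2⟩⇒combination : ∀ {v a c : R α β} → v ∈⟨ a ∷ c ∷ [] ⟩ →
                     Σ (Poly Z₄) λ l₁ → Σ (Poly Z₄) λ l₂ → v ≡ (l₁ ⋆ a) +R (l₂ ⋆ c)
  ∈⟨2⟩⇒combination {a = a} {c} (l₁ , _ , (l₂ , _ , refl , refl) , refl) =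
    l₁ , l₂ , cong ((l₁ ⋆ a) +R_) (+R-identityʳ (l₂ ⋆ c))

  combination∈⟨2⟩ : ∀ {a c : R α β} l₁ l₂ → ((l₁ ⋆ a) +R (l₂ ⋆ c)) ∈⟨ a ∷ c ∷ [] ⟩
  combination∈⟨2⟩ {c = c} l₁ l₂ = l₁ , l₂ ⋆ c , (l₂ , 0R , refl , sym (+R-identityʳ (l₂ ⋆ c))) , refl

  ∈⟨3⟩⇒combination : ∀ {v a c d : R α β} → v ∈⟨ a ∷ c ∷ d ∷ [] ⟩ →
                     Σ (Poly Z₄) λ l₁ → Σ (Poly Z₄) λ l₂ → Σ (Poly Z₄) λ l₃ →
                     v ≡ (l₁ ⋆ a) +R ((l₂ ⋆ c) +R (l₃ ⋆ d))
  ∈⟨3⟩⇒combination (l₁ , w , w∈ , refl) with ∈⟨2⟩⇒combination w∈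
  ... | l₂ , l₃ , refl = l₁ , l₂ , l₃ , refl

  combination∈⟨3⟩ : ∀ {a c d : R α β} l₁ l₂ l₃ → ((l₁ ⋆ a) +R ((l₂ ⋆ c) +R (l₃ ⋆ d))) ∈⟨ a ∷ c ∷ d ∷ [] ⟩
  combination∈⟨3⟩ {c = c} {d} l₁ l₂ l₃ = l₁ , (l₂ ⋆ c) +R (l₃ ⋆ d) , combination∈⟨2⟩ l₂ l₃ , refl

  order2⇒quaternary-even : ∀ p q → OrderLe2 {α} {β} [ p ∣ q ] → P₂.reduce β (mod2 q) ≡ Red₂.0ᵥ β
  order2⇒quaternary-even p q ord = trans (mod2-reduce β q) (order2⇒even (P₄.reduce β q) (cong R.quat ord))

  order2-[∣2·] : ∀ p t → OrderLe2 {α} {β} [ p ∣ 2· t ]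
  order2-[∣2·] p t = cong₂ ⟪_∣_⟫ (order2-Z₂ (P₂.reduce α p))
    (trans (cong (λ u → u Red₄.+ᵥ u) (Red₄.reduce-scale β 2₄ t)) (order2-double (P₄.reduce β t)))

module OrderTwoSubcode (α k : ℕ) (f g h : Poly Z₄) (b ℓ : Poly Z₂)
                       (factorisation : P₄._≈ₚ_ (f *⁴ h *⁴ g) (P₄.xⁿ-1 3₄ (suc k))) where

  β : ℕ
  β = suc k

  F : Poly Z₄
  F = f *⁴ h +⁴ 2· f

  gen-b gen-ℓ gen-ℓg gen-fh : R α β
  gen-b  = [ b ∣ [] ]
  gen-ℓ  = [ ℓ ∣ F ]
  gen-ℓg = [ ℓ *² mod2 g ∣ 2· (f *⁴ g) ]
  gen-fh = [ [] ∣ 2· (f *⁴ h) ]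

  fhg≈X : f *⁴ h *⁴ g ≈⁴ Red₄.X β
  fhg≈X = Z₄x.mk factorisation

  split-binary : ∀ μ ν → mod2 (g *⁴ μ +⁴ 2· ν) *² ℓ ≈² mod2 μ *² (ℓ *² mod2 g) +² mod2 ν *² []
  split-binary μ ν = begin
    mod2 (g *⁴ μ +⁴ 2· ν) *² ℓ
      ≈⟨ Z₂x.*-congˡ ℓ (Z₂x.≡⇒≈ (trans (mod2-+ (g *⁴ μ) (2· ν)) (cong (_+² mod2 (2· ν)) (mod2-* g μ)))) ⟩
    (mod2 g *² mod2 μ +² mod2 (2· ν)) *² ℓ
      ≈⟨ Z₂x.*-congˡ ℓ (Z₂x.≈-trans (Z₂x.+-cong (Z₂x.≈-refl {mod2 g *² mod2 μ}) (mod2-2· ν)) (Z₂x.+-idʳₚ _)) ⟩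
    mod2 g *² mod2 μ *² ℓ
      ≈⟨ solve 3 (λ g μ ℓ → g :* μ :* ℓ := μ :* (ℓ :* g)) Z₂x.≈-refl (mod2 g) (mod2 μ) ℓ ⟩
    mod2 μ *² (ℓ *² mod2 g)
      ≈⟨ Z₂x.≈-trans (Z₂x.+-cong (Z₂x.≈-refl {mod2 μ *² (ℓ *² mod2 g)}) (Z₂x.*-zeroʳₚ (mod2 ν))) (Z₂x.+-idʳₚ _) ⟨
    mod2 μ *² (ℓ *² mod2 g) +² mod2 ν *² [] ∎
    where
    open SetoidReasoning Z₂x.setoid
    open Z₂x using (solve; _:=_; _:*_)

  -- the quaternary part of (g·μ + 2·ν)·(fh + 2f) is μ·2fg + ν·2fh plus a
  -- multiple of fhg = xᵝ - 1 (using 2·2 = 0)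
  split-quaternary : ∀ μ ν → P₄.reduce β ((g *⁴ μ +⁴ 2· ν) *⁴ F) ≡
                             P₄.reduce β (μ *⁴ 2· (f *⁴ g) +⁴ ν *⁴ 2· (f *⁴ h))
  split-quaternary μ ν = trans (Red₄.reduce-cong β expand) (Red₄.reduce-+-multiple β fhg≈X S μ)
    where
    open SetoidReasoning Z₄x.setoid
    open Z₄x using (solve; _:=_; _:+_; _:*_)
    two S : Poly Z₄
    two = 2₄ ∷ []
    S   = μ *⁴ 2· (f *⁴ g) +⁴ ν *⁴ 2· (f *⁴ h)
    expand : (g *⁴ μ +⁴ 2· ν) *⁴ F ≈⁴ S +⁴ f *⁴ h *⁴ g *⁴ μ
    expand = begin
      (g *⁴ μ +⁴ 2· ν) *⁴ (f *⁴ h +⁴ 2· f)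
        ≈⟨ Z₄x.*-cong (Z₄x.+-cong (Z₄x.≈-refl {g *⁴ μ}) (2·-as-product ν))
                      (Z₄x.+-cong (Z₄x.≈-refl {f *⁴ h}) (2·-as-product f)) ⟨
      (g *⁴ μ +⁴ two *⁴ ν) *⁴ (f *⁴ h +⁴ two *⁴ f)
        ≈⟨ solve 6 (λ g μ t ν f h → (g :* μ :+ t :* ν) :* (f :* h :+ t :* f)
                                     := μ :* (t :* (f :* g)) :+ ν :* (t :* (f :* h))
                                        :+ (f :* h :* g :* μ :+ t :* t :* (ν :* f)))
                   Z₄x.≈-refl g μ two ν f h ⟩
      μ *⁴ (two *⁴ (f *⁴ g)) +⁴ ν *⁴ (two *⁴ (f *⁴ h)) +⁴ (f *⁴ h *⁴ g *⁴ μ +⁴ two *⁴ two *⁴ (ν *⁴ f))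
        ≈⟨ Z₄x.+-cong (Z₄x.+-cong (Z₄x.*-congʳ μ (2·-as-product (f *⁴ g))) (Z₄x.*-congʳ ν (2·-as-product (f *⁴ h))))
                      (Z₄x.+-cong (Z₄x.≈-refl {f *⁴ h *⁴ g *⁴ μ}) (Z₄x.*-zeroˡₚ (ν *⁴ f) 2·2≈0)) ⟩
      S +⁴ (f *⁴ h *⁴ g *⁴ μ +⁴ [])
        ≈⟨ Z₄x.+-cong (Z₄x.≈-refl {S}) (Z₄x.+-idʳₚ _) ⟩
      S +⁴ f *⁴ h *⁴ g *⁴ μ ∎

  split-generator : ∀ μ ν → (g *⁴ μ +⁴ 2· ν) ⋆ gen-ℓ ≡ (μ ⋆ gen-ℓg) +R (ν ⋆ gen-fh)
  split-generator μ ν = begin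
    l ⋆ gen-ℓ                        ≡⟨ ⋆-[] l ℓ F ⟩
    [ mod2 l *² ℓ ∣ l *⁴ F ]         ≡⟨ []-cong (l *⁴ F) S (split-binary μ ν) (split-quaternary μ ν) ⟩
    [ mod2 μ *² (ℓ *² mod2 g) +² mod2 ν *² [] ∣ S ]
                                     ≡⟨ ⋆+⋆-[] μ ν (ℓ *² mod2 g) (2· (f *⁴ g)) [] (2· (f *⁴ h)) ⟨
    (μ ⋆ gen-ℓg) +R (ν ⋆ gen-fh)     ∎
    where
    open ≡-Reasoning
    l S : Poly Z₄
    l = g *⁴ μ +⁴ 2· ν
    S = μ *⁴ 2· (f *⁴ g) +⁴ ν *⁴ 2· (f *⁴ h)

  f̄h̄ : Poly Z₂
  f̄h̄ = mod2 f *² mod2 h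

  mod2-F : mod2 F ≈² f̄h̄
  mod2-F = Z₂x.≈-trans (Z₂x.≡⇒≈ (trans (mod2-+ (f *⁴ h) (2· f)) (cong (_+² mod2 (2· f)) (mod2-* f h))))
                       (Z₂x.≈-trans (Z₂x.+-cong (Z₂x.≈-refl {f̄h̄}) (mod2-2· f)) (Z₂x.+-idʳₚ _))

  mod2-factorisation : Red₂.X β ≈² f̄h̄ *² mod2 g
  mod2-factorisation = begin
    Red₂.X β                ≡⟨ mod2-X β ⟨
    mod2 (Red₄.X β)         ≈⟨ mod2-cong fhg≈X ⟨
    mod2 (f *⁴ h *⁴ g)      ≡⟨ trans (mod2-* (f *⁴ h) g) (cong (_*² mod2 g) (mod2-* f h)) ⟩
    f̄h̄ *² mod2 g            ∎
    where open SetoidReasoning Z₂x.setoid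

  mod2-quaternary : ∀ l₁ l₂ → mod2 (l₁ *⁴ [] +⁴ l₂ *⁴ F) ≈² mod2 l₂ *² f̄h̄
  mod2-quaternary l₁ l₂ = begin
    mod2 (l₁ *⁴ [] +⁴ l₂ *⁴ F)   ≈⟨ mod2-cong (Z₄x.+-cong (Z₄x.*-zeroʳₚ l₁) (Z₄x.≈-refl {l₂ *⁴ F})) ⟩
    mod2 (l₂ *⁴ F)               ≡⟨ mod2-* l₂ F ⟩
    mod2 l₂ *² mod2 F            ≈⟨ Z₂x.*-congʳ (mod2 l₂) mod2-F ⟩
    mod2 l₂ *² f̄h̄                ∎
    where open SetoidReasoning Z₂x.setoid

  order2⇒l̄₂f̄h̄↦0 : ∀ l₁ l₂ → OrderLe2 ((l₁ ⋆ gen-b) +R (l₂ ⋆ gen-ℓ)) → P₂.reduce β (mod2 l₂ *² f̄h̄) ≡ Red₂.0ᵥ β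
  order2⇒l̄₂f̄h̄↦0 l₁ l₂ ord = begin
    P₂.reduce β (mod2 l₂ *² f̄h̄)     ≡⟨ Red₂.reduce-cong β (mod2-quaternary l₁ l₂) ⟨
    P₂.reduce β (mod2 quaternary)   ≡⟨ order2⇒quaternary-even binary quaternary as-[∣] ⟩
    Red₂.0ᵥ β                       ∎
    where
    open ≡-Reasoning
    binary : Poly Z₂
    binary = mod2 l₁ *² b +² mod2 l₂ *² ℓ
    quaternary : Poly Z₄
    quaternary = l₁ *⁴ [] +⁴ l₂ *⁴ F
    as-[∣] : OrderLe2 [ binary ∣ quaternary ]
    as-[∣] = subst OrderLe2 (⋆+⋆-[] l₁ l₂ b [] ℓ F) ord

  order2⇒ḡ∣l̄₂ : P₄.Coprime f g → P₄.Coprime g h → ∀ l₁ l₂ →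
                 OrderLe2 ((l₁ ⋆ gen-b) +R (l₂ ⋆ gen-ℓ)) → mod2 g P₂.∣ₚ mod2 l₂
  order2⇒ḡ∣l̄₂ f⊥g g⊥h l₁ l₂ ord with Red₂.reduce≡0⇒multiple k (mod2 l₂ *² f̄h̄) (order2⇒l̄₂f̄h̄↦0 l₁ l₂ ord)
  ... | q , l̄₂f̄h̄≈Xq = Z₂x.coprime-∣ {l = mod2 l₂} f̄h̄⊥ḡ (f̄h̄ *² q , Z₂x.get (begin
    mod2 g *² (f̄h̄ *² q)   ≈⟨ solve 3 (λ g a q → g :* (a :* q) := a :* g :* q) Z₂x.≈-refl (mod2 g) f̄h̄ q ⟩
    f̄h̄ *² mod2 g *² q     ≈⟨ Z₂x.*-congˡ q mod2-factorisation ⟨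
    Red₂.X β *² q         ≈⟨ l̄₂f̄h̄≈Xq ⟨
    mod2 l₂ *² f̄h̄         ∎))
    where
    open SetoidReasoning Z₂x.setoid
    open Z₂x using (solve; _:=_; _:*_)
    f̄h̄⊥ḡ : P₂.Coprime f̄h̄ (mod2 g)
    f̄h̄⊥ḡ = Z₂x.coprime-* (mod2-coprime f⊥g) (mod2-coprime g⊥h)

  order2⇒split-coefficient : P₄.Coprime f g → P₄.Coprime g h → ∀ l₁ l₂ →
                             OrderLe2 ((l₁ ⋆ gen-b) +R (l₂ ⋆ gen-ℓ)) →
                             Σ (Poly Z₄) λ μ → Σ (Poly Z₄) λ ν → l₂ ≈⁴ g *⁴ μ +⁴ 2· ν
  order2⇒split-coefficient f⊥g g⊥h l₁ l₂ ord = mod2-factor⇒split l₂ g (proj₁ ḡ∣l̄₂) (Z₂x.≈-sym ḡm≈l̄₂)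
    where
    ḡ∣l̄₂ : mod2 g P₂.∣ₚ mod2 l₂
    ḡ∣l̄₂ = order2⇒ḡ∣l̄₂ f⊥g g⊥h l₁ l₂ ord
    ḡm≈l̄₂ : mod2 g *² proj₁ ḡ∣l̄₂ ≈² mod2 l₂
    ḡm≈l̄₂ = Z₂x.mk (proj₂ ḡ∣l̄₂)

  -- every combination of (b ∣ 0), (ℓḡ ∣ 2fg), (0 ∣ 2fh) has quaternary part
  -- 2·(μ·fg + ν·fh), hence order ≤ 2
  combination₃-order2 : ∀ l₁ μ ν → OrderLe2 ((l₁ ⋆ gen-b) +R ((μ ⋆ gen-ℓg) +R (ν ⋆ gen-fh)))
  combination₃-order2 l₁ μ ν = subst OrderLe2 (sym as-[∣2·]) (order2-[∣2·] binary T)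
    where
    binary-ℓg,fh binary : Poly Z₂
    binary-ℓg,fh = mod2 μ *² (ℓ *² mod2 g) +² mod2 ν *² []
    binary       = mod2 l₁ *² b +² binary-ℓg,fh
    quaternary-ℓg,fh quaternary T : Poly Z₄
    quaternary-ℓg,fh = μ *⁴ 2· (f *⁴ g) +⁴ ν *⁴ 2· (f *⁴ h)
    quaternary       = l₁ *⁴ [] +⁴ quaternary-ℓg,fh
    T                = μ *⁴ (f *⁴ g) +⁴ ν *⁴ (f *⁴ h)
    quaternary≈2T : quaternary ≈⁴ 2· T
    quaternary≈2T = begin
      quaternary
        ≈⟨ Z₄x.+-cong (Z₄x.*-zeroʳₚ l₁) Z₄x.≈-refl ⟩
      quaternary-ℓg,fh
        ≈⟨ Z₄x.+-cong (Z₄x.*-congʳ μ (2·-as-product (f *⁴ g))) (Z₄x.*-congʳ ν (2·-as-product (f *⁴ h))) ⟨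
      μ *⁴ (two *⁴ (f *⁴ g)) +⁴ ν *⁴ (two *⁴ (f *⁴ h))
        ≈⟨ solve 5 (λ μ ν t a c → μ :* (t :* a) :+ ν :* (t :* c) := t :* (μ :* a :+ ν :* c))
                   Z₄x.≈-refl μ ν two (f *⁴ g) (f *⁴ h) ⟩
      two *⁴ T
        ≈⟨ 2·-as-product T ⟩
      2· T ∎
      where
      open SetoidReasoning Z₄x.setoid
      open Z₄x using (solve; _:=_; _:+_; _:*_)
      two : Poly Z₄
      two = 2₄ ∷ []
    as-[∣2·] : (l₁ ⋆ gen-b) +R ((μ ⋆ gen-ℓg) +R (ν ⋆ gen-fh)) ≡ [ binary ∣ 2· T ]
    as-[∣2·] = begin
      (l₁ ⋆ gen-b) +R ((μ ⋆ gen-ℓg) +R (ν ⋆ gen-fh))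
        ≡⟨ cong₂ _+R_ (⋆-[] l₁ b []) (⋆+⋆-[] μ ν (ℓ *² mod2 g) (2· (f *⁴ g)) [] (2· (f *⁴ h))) ⟩
      [ mod2 l₁ *² b ∣ l₁ *⁴ [] ] +R [ binary-ℓg,fh ∣ quaternary-ℓg,fh ]
        ≡⟨ +R-[] (mod2 l₁ *² b) (l₁ *⁴ []) binary-ℓg,fh quaternary-ℓg,fh ⟩
      [ binary ∣ quaternary ]
        ≡⟨ []-cong quaternary (2· T) (Z₂x.≈-refl {binary}) (Red₄.reduce-cong β quaternary≈2T) ⟩
      [ binary ∣ 2· T ] ∎
      where open ≡-Reasoning

  -- C_b ⊆ ⟨(b ∣ 0), (ℓḡ ∣ 2fg), (0 ∣ 2fh)⟩: write l₂ = g·μ + 2·ν and split the generator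
  order2⇒∈span₃ : P₄.Coprime f g → P₄.Coprime g h → ∀ v → v ∈⟨ gen-b ∷ gen-ℓ ∷ [] ⟩ → OrderLe2 v →
                  v ∈⟨ gen-b ∷ gen-ℓg ∷ gen-fh ∷ [] ⟩
  order2⇒∈span₃ f⊥g g⊥h v v∈C ord with ∈⟨2⟩⇒combination v∈C
  ... | l₁ , l₂ , refl = subst (_∈⟨ gen-b ∷ gen-ℓg ∷ gen-fh ∷ [] ⟩) (sym same-element) (combination∈⟨3⟩ l₁ μ ν)
    where
    split : Σ (Poly Z₄) λ μ → Σ (Poly Z₄) λ ν → l₂ ≈⁴ g *⁴ μ +⁴ 2· ν
    split = order2⇒split-coefficient f⊥g g⊥h l₁ l₂ ord
    μ ν : Poly Z₄
    μ = proj₁ split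
    ν = proj₁ (proj₂ split)
    same-element : (l₁ ⋆ gen-b) +R (l₂ ⋆ gen-ℓ) ≡ (l₁ ⋆ gen-b) +R ((μ ⋆ gen-ℓg) +R (ν ⋆ gen-fh))
    same-element = cong ((l₁ ⋆ gen-b) +R_) (trans (⋆-congˡ gen-ℓ (proj₂ (proj₂ split))) (split-generator μ ν))

  -- ⟨(b ∣ 0), (ℓḡ ∣ 2fg), (0 ∣ 2fh)⟩ ⊆ C, again by splitting the generator
  span₃⊆C : ∀ v → v ∈⟨ gen-b ∷ gen-ℓg ∷ gen-fh ∷ [] ⟩ → v ∈⟨ gen-b ∷ gen-ℓ ∷ [] ⟩
  span₃⊆C v v∈ with ∈⟨3⟩⇒combination v∈
  ... | l₁ , μ , ν , refl = subst (_∈⟨ gen-b ∷ gen-ℓ ∷ [] ⟩) (cong ((l₁ ⋆ gen-b) +R_) (split-generator μ ν))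
                                  (combination∈⟨2⟩ l₁ (g *⁴ μ +⁴ 2· ν))

  span₃⊆order2 : ∀ v → v ∈⟨ gen-b ∷ gen-ℓg ∷ gen-fh ∷ [] ⟩ → OrderLe2 v
  span₃⊆order2 v v∈ with ∈⟨3⟩⇒combination v∈
  ... | l₁ , μ , ν , refl = combination₃-order2 l₁ μ ν

-- The subcode C_b of codewords of order ≤ 2 is ⟨(b ∣ 0), (ℓg ∣ 2fg), (0 ∣ 2fh)⟩.
-- Only the factorisation fhg = xᵝ - 1 (β ≥ 1) and the coprimality of g with
-- f and with h are needed.
mainTheorem2 : (α β : ℕ) → β % 2 ≡ 1 →
    (f g h : Poly Z₄) → P₄.Monic f → P₄.Monic g → P₄.Monic h →
    P₄.Coprime f g → P₄.Coprime f h → P₄.Coprime g h →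
    P₄._≈ₚ_ (P₄._*ₚ_ (P₄._*ₚ_ f h) g) (P₄.xⁿ-1 3₄ β) →
    (b ℓ : Poly Z₂) → P₂._∣ₚ_ b (P₂.xⁿ-1 1₂ α) → P₂.DegLt ℓ b →
    P₂._∣ₚ_ b (P₂._*ₚ_ (mod2 (P₄._*ₚ_ h g)) ℓ) →
    (v : R α β) →
    ((v ∈⟨ [ b ∣ [] ] ∷ [ ℓ ∣ P₄._+ₚ_ (P₄._*ₚ_ f h) (2· f) ] ∷ [] ⟩ × OrderLe2 v)
    ⇔ (v ∈⟨ [ b ∣ [] ] ∷ [ P₂._*ₚ_ ℓ (mod2 g) ∣ 2· (P₄._*ₚ_ f g) ] ∷ [ [] ∣ 2· (P₄._*ₚ_ f h) ] ∷ [] ⟩))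
mainTheorem2 α zero    () _ _ _ _ _ _ _ _ _ _ _ _ _ _ _ _
mainTheorem2 α (suc k) _  f g h _ _ _ f⊥g _ g⊥h fhg≡xᵝ-1 b ℓ _ _ _ v =
  mk⇔ (λ (v∈C , ord) → order2⇒∈span₃ f⊥g g⊥h v v∈C ord)
      (λ v∈span → span₃⊆C v v∈span , span₃⊆order2 v v∈span)
  where open OrderTwoSubcode α k f g h b ℓ fhg≡xᵝ-1
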